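{- Let $p$ be a prime, $k \ge 0$ an integer, and $n = (k+1)p - 1$. Then the base-$p$ expansion of the positive integer $\sum_{m=0}^{n} p^{v_p(m!)}$ has exactly $v_p(n!) + 2$ digits.
   Context: For a prime $p$ and a positive integer $m$, $v_p(m)$ denotes the exponent of the highest power of $p$ dividing $m$ (so $v_p(0!) = v_p(1!) = 0$). The integers $n$ of the form $(k+1)p-1$ are exactly the largest elements of the blocks (``packages'') $\{kp, kp+1, \dots, (k+1)p-1\}$. -}

module Defs where

open import Data.Nat using (ℕ; zero; suc; _+_; _*_; _^_; _≤_; _<_; NonZero)
open import Data.Nat.DivMod using (_/_; _%_)

open import Data.Nat.Primality using (Prime)
open import Data.Nat.Properties using (_≟_)
open import Relation.Nullary using (yes; no)
open import Data.Empty using (⊥)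
open import Data.Product using (_×_)

vp-fuel : ℕ → (p : ℕ) → .{{NonZero p}} → ℕ → ℕ
vp-fuel zero    p m = 0
vp-fuel (suc f) p m with m % p ≟ 0
... | yes _ = suc (vp-fuel f p (m / p))
... | no  _ = 0

-- v_p(m) for m ≥ 1 (for p ≥ 2, m fuel steps always suffice since p^v ≤ m).
-- Convention: v_p(0) = 0 (never used below, since factorials are ≥ 1).
v : (p : ℕ) → .{{NonZero p}} → ℕ → ℕ
v p zero = 0
v p m@(suc _) = vp-fuel m p m

sumTo : ℕ → (ℕ → ℕ) → ℕ
sumTo zero    f = f 0
sumTo (suc n) f = sumTo n f + f (suc n)

HasDigits : (b N d : ℕ) → Set
HasDigits b N zero    = ⊥
HasDigits b N (suc d) = b ^ d ≤ N × N < b ^ suc d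

{-# OPTIONS --safe #-}
-- Inside a package {kp, …, (k+1)p − 1} the valuation v_p(m!) is constant, so the package
-- contributes p · p^{v_p((kp)!)} to the sum.  Let S_k be the sum up to n_k = (k+1)p − 1 and
-- V_k = v_p(n_k!).  By induction on k, p^{V_k+1} ≤ S_k and S_k + p ≤ p^{V_k+2}: the lower
-- bound is the last term of the sum, and since V_{k+1} ≥ V_k + 1 (as p ∣ (k+1)p) the next
-- package adds p^{V_{k+1}+1} ≥ S_k + p, whence S_{k+1} + p ≤ 2 p^{V_{k+1}+1} ≤ p^{V_{k+1}+2}.
module Submission where

open import Defs
open import Data.Nat using (ℕ; zero; suc; _+_; _*_; _∸_; _^_; _!; _≤_; _<_; s≤s; z<s; NonZero; nonTrivial⇒n>1; >-nonZero; >-nonZero⁻¹; ≢-nonZero⁻¹)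
open import Data.Nat.Properties
open import Data.Nat.Divisibility
open import Data.Nat.DivMod using (_/_; _%_; m/n*n≡m; m/n<m; m≥n⇒m/n>0)
open import Data.Nat.Primality using (Prime; prime⇒nonZero; prime⇒nonTrivial; euclidsLemma)
open import Data.Product using (_×_; _,_; proj₁; proj₂)
open import Data.Sum using (inj₁; inj₂)
open import Relation.Nullary using (¬_; yes; no; contradiction)
open import Relation.Binary.PropositionalEquality

ExactPower : (p e m : ℕ) → Set
ExactPower p e m = p ^ e ∣ m × ¬ p ^ suc e ∣ m

^-monoʳ-∣ : ∀ p {a b} → a ≤ b → p ^ a ∣ p ^ b
^-monoʳ-∣ p {a} {b} a≤b = divides (p ^ (b ∸ a)) (begin
  p ^ b                ≡⟨ cong (p ^_) (m+[n∸m]≡n a≤b) ⟨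
  p ^ (a + (b ∸ a))    ≡⟨ ^-distribˡ-+-* p a (b ∸ a) ⟩
  p ^ a * p ^ (b ∸ a)  ≡⟨ *-comm (p ^ a) _ ⟩
  p ^ (b ∸ a) * p ^ a  ∎)
  where open ≡-Reasoning

exactPower-maximal : ∀ {p e d m} → ExactPower p e m → p ^ d ∣ m → d ≤ e
exactPower-maximal {p} {e} {d} (_ , ∤m) p^d∣m with d ≤? e
... | yes d≤e = d≤e
... | no  d≰e = contradiction (∣-trans (^-monoʳ-∣ p (≰⇒> d≰e)) p^d∣m) ∤m

exactPower-unique : ∀ {p e e′ m} → ExactPower p e m → ExactPower p e′ m → e ≡ e′
exactPower-unique h h′ = ≤-antisym (exactPower-maximal h′ (proj₁ h)) (exactPower-maximal h (proj₁ h′))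

-- Writing p = suc q makes suc k * p ∸ 1, the end of the k-th package, reduce to q + k * p.
module _ {q : ℕ} (pp : Prime (suc q)) where

  private
    p : ℕ
    p = suc q

    1<p : 1 < p
    1<p = nonTrivial⇒n>1 p {{prime⇒nonTrivial pp}}

  vp-fuel-exact : ∀ f m → .{{NonZero m}} → m ≤ f → ExactPower p (vp-fuel f p m) m
  vp-fuel-exact zero    m m≤0 = contradiction (n≤0⇒n≡0 m≤0) (≢-nonZero⁻¹ m)
  vp-fuel-exact (suc f) m m≤f with m % p ≟ 0
  ... | no  p∤m = 1∣ m , λ p∣m → p∤m (n∣m⇒m%n≡0 m p (m*n∣⇒m∣ p 1 p∣m))
  ... | yes m%p≡0 = subst (p ^ suc e ∣_) m≡p*m/p (*-monoʳ-∣ p (proj₁ ih))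
                , λ p^2+e∣m → proj₂ ih (*-cancelˡ-∣ p (subst (p ^ suc (suc e) ∣_) (sym m≡p*m/p) p^2+e∣m))
    where
    p∣m : p ∣ m
    p∣m = m%n≡0⇒n∣m m p m%p≡0

    m≡p*m/p : p * (m / p) ≡ m
    m≡p*m/p = trans (*-comm p (m / p)) (m/n*n≡m p∣m)

    instance
      m/p≢0 : NonZero (m / p)
      m/p≢0 = >-nonZero (m≥n⇒m/n>0 (∣⇒≤ p∣m))

    ih : ExactPower p (vp-fuel f p (m / p)) (m / p)
    ih = vp-fuel-exact f (m / p) (≤-pred (≤-trans (m/n<m m p 1<p) m≤f))

    e : ℕ
    e = vp-fuel f p (m / p)

  v-exact : ∀ m → .{{NonZero m}} → ExactPower p (v p m) m
  v-exact (suc m) = vp-fuel-exact (suc m) (suc m) ≤-refl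

  ^∣⇒≤v : ∀ {d} m → .{{NonZero m}} → p ^ d ∣ m → d ≤ v p m
  ^∣⇒≤v m = exactPower-maximal (v-exact m)

  v[1]≡0 : v p 1 ≡ 0
  v[1]≡0 = exactPower-unique (v-exact 1) (1∣ 1 , λ p∣1 → <⇒≱ 1<p (subst (_≤ 1) (*-identityʳ p) (∣⇒≤ p∣1)))

  ^∣-cancelˡ-indivisible : ∀ {a c} e → ¬ p ∣ a → p ^ e ∣ a * c → p ^ e ∣ c
  ^∣-cancelˡ-indivisible {c = c} zero    _   _ = 1∣ c
  ^∣-cancelˡ-indivisible {a} {c} (suc e) p∤a p^1+e∣ac
    with euclidsLemma a c pp (m*n∣⇒m∣ p (p ^ e) p^1+e∣ac)
  ... | inj₁ p∣a = contradiction p∣a p∤a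
  ... | inj₂ (divides c′ refl) = subst (p * p ^ e ∣_) (*-comm p c′) (*-monoʳ-∣ p p^e∣c′)
    where
    ac≡p*ac′ : a * (c′ * p) ≡ p * (a * c′)
    ac≡p*ac′ = begin
      a * (c′ * p)  ≡⟨ cong (a *_) (*-comm c′ p) ⟩
      a * (p * c′)  ≡⟨ *-assoc a p c′ ⟨
      a * p * c′    ≡⟨ cong (_* c′) (*-comm a p) ⟩
      p * a * c′    ≡⟨ *-assoc p a c′ ⟩
      p * (a * c′)  ∎
      where open ≡-Reasoning

    p^e∣c′ : p ^ e ∣ c′
    p^e∣c′ = ^∣-cancelˡ-indivisible e p∤a (*-cancelˡ-∣ p (subst (p * p ^ e ∣_) ac≡p*ac′ p^1+e∣ac))

  v-*-indivisible : ∀ a c → .{{NonZero a}} → .{{NonZero c}} → ¬ p ∣ a → v p (a * c) ≡ v p c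
  v-*-indivisible a c p∤a = exactPower-unique (v-exact (a * c) {{m*n≢0 a c}})
    ( ∣n⇒∣m*n a (proj₁ (v-exact c))
    , λ p^∣ac → proj₂ (v-exact c) (^∣-cancelˡ-indivisible (suc (v p c)) p∤a p^∣ac))

  v[suc-n!]>v[n!] : ∀ n → p ∣ suc n → v p (n !) < v p (suc n !)
  v[suc-n!]>v[n!] n p∣1+n = ^∣⇒≤v (suc n !) {{suc n !≢0}}
    (*-pres-∣ p∣1+n (proj₁ (v-exact (n !) {{n !≢0}})))

  indivisible-in-package : ∀ {j} k → 0 < j → j < p → ¬ p ∣ j + k * p
  indivisible-in-package {j} k 0<j j<p p∣j+kp =
    <⇒≱ j<p (∣⇒≤ {{>-nonZero 0<j}} (∣m+n∣n⇒∣m p∣j+kp (n∣m*n k)))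
    where
    ∣m+n∣n⇒∣m : ∀ {d m n} → d ∣ m + n → d ∣ n → d ∣ m
    ∣m+n∣n⇒∣m {d} {m} {n} d∣m+n = ∣m+n∣m⇒∣n (subst (d ∣_) (+-comm m n) d∣m+n)

  v-!-constant-in-package : ∀ k j → j < p → v p ((j + k * p) !) ≡ v p ((k * p) !)
  v-!-constant-in-package k zero    _     = refl
  v-!-constant-in-package k (suc j) 1+j<p = begin
    v p (suc (j + k * p) * (j + k * p) !)
      ≡⟨ v-*-indivisible (suc (j + k * p)) _ {{_}} {{(j + k * p) !≢0}} (indivisible-in-package k z<s 1+j<p) ⟩
    v p ((j + k * p) !)
      ≡⟨ v-!-constant-in-package k j (<-trans (n<1+n j) 1+j<p) ⟩
    v p ((k * p) !) ∎
    where open ≡-Reasoning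

  private
    term : ℕ → ℕ
    term m = p ^ v p (m !)

  packageSum packageV : ℕ → ℕ
  packageSum k = sumTo (q + k * p) term
  packageV   k = v p ((q + k * p) !)

  sumTo-within-package : ∀ k j → j < p →
    sumTo (j + suc k * p) term ≡ packageSum k + suc j * p ^ v p ((suc k * p) !)
  sumTo-within-package k zero    _     = cong (packageSum k +_) (sym (+-identityʳ _))
  sumTo-within-package k (suc j) 1+j<p = begin
    sumTo (j + suc k * p) term + term (suc j + suc k * p)
      ≡⟨ cong₂ _+_ (sumTo-within-package k j (<-trans (n<1+n j) 1+j<p))
                   (cong (p ^_) (v-!-constant-in-package (suc k) (suc j) 1+j<p)) ⟩
    packageSum k + suc j * x + x
      ≡⟨ +-assoc (packageSum k) _ x ⟩
    packageSum k + (suc j * x + x)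
      ≡⟨ cong (packageSum k +_) (+-comm (suc j * x) x) ⟩
    packageSum k + suc (suc j) * x ∎
    where
    open ≡-Reasoning
    x = p ^ v p ((suc k * p) !)

  sumTo-first-package : ∀ j → j < p → sumTo (j + 0 * p) term ≡ suc j
  sumTo-first-package zero    _     = cong (p ^_) v[1]≡0
  sumTo-first-package (suc j) 1+j<p = begin
    sumTo (j + 0) term + term (suc j + 0)
      ≡⟨ cong₂ _+_ (sumTo-first-package j (<-trans (n<1+n j) 1+j<p))
                   (cong (p ^_) (trans (v-!-constant-in-package 0 (suc j) 1+j<p) v[1]≡0)) ⟩
    suc j + 1
      ≡⟨ +-comm (suc j) 1 ⟩
    suc (suc j) ∎
    where open ≡-Reasoning

  x+x≤p*x : ∀ x → x + x ≤ p * x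
  x+x≤p*x x = subst (_≤ p * x) (cong (x +_) (+-identityʳ x)) (*-monoˡ-≤ x 1<p)

  -- A strengthening of HasDigits p s (e + 2) that is preserved from one package to the next.
  Bounds : ℕ → ℕ → Set
  Bounds s e = p ^ suc e ≤ s × s + p ≤ p ^ suc (suc e)

  Bounds⇒HasDigits : ∀ {s e} → Bounds s e → HasDigits p s (e + 2)
  Bounds⇒HasDigits {s} {e} (p^1+e≤s , s+p≤p^2+e) rewrite +-comm e 2 =
    p^1+e≤s , <-≤-trans (m<m+n s (>-nonZero⁻¹ p)) s+p≤p^2+e

  bounds-next-package : ∀ {s e w} → Bounds s e → e < w → Bounds (s + p * p ^ w) w
  bounds-next-package {s} {e} {w} (_ , s+p≤p^2+e) e<w = m≤n+m x s , (begin
    s + x + p    ≡⟨ +-assoc s x p ⟩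
    s + (x + p)  ≡⟨ cong (s +_) (+-comm x p) ⟩
    s + (p + x)  ≡⟨ +-assoc s p x ⟨
    s + p + x    ≤⟨ +-monoˡ-≤ x (≤-trans s+p≤p^2+e (^-monoʳ-≤ p (s≤s e<w))) ⟩
    x + x        ≤⟨ x+x≤p*x x ⟩
    p * x        ∎)
    where
    open ≤-Reasoning
    x = p * p ^ w

  packageSum-bounds : ∀ k → Bounds (packageSum k) (packageV k)
  packageSum-bounds zero
    rewrite sumTo-first-package q ≤-refl | v-!-constant-in-package 0 q ≤-refl | v[1]≡0
    = ≤-reflexive (*-identityʳ p) , subst (λ x → p + p ≤ p * x) (sym (*-identityʳ p)) (x+x≤p*x p)
  packageSum-bounds (suc k)
    rewrite sumTo-within-package k q ≤-refl | v-!-constant-in-package (suc k) q ≤-refl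
    = bounds-next-package (packageSum-bounds k) (v[suc-n!]>v[n!] (q + k * p) (n∣m*n (suc k)))

proposition2 : (p : ℕ) → (pp : Prime p) → (k : ℕ) →
    HasDigits p
      (sumTo (suc k * p ∸ 1) (λ m → p ^ v p {{prime⇒nonZero pp}} (m !)))
      (v p {{prime⇒nonZero pp}} ((suc k * p ∸ 1) !) + 2)
proposition2 zero    pp = contradiction (nonTrivial⇒n>1 0 {{prime⇒nonTrivial pp}}) λ ()
proposition2 (suc q) pp k = Bounds⇒HasDigits pp (packageSum-bounds pp k)
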